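{- Let $n \geq 3$. In the game PAP with pattern length $k=3$, the Sprague--Grundy value of the starting position $S_n$ is $0$; that is, $\operatorname{sg}(S_n,3)=0$, so $S_n$ is a P-position (the second player wins).
   Context: $S_n$ is the set of permutations of $\{1,\dots,n\}$ in one-line notation. A permutation $\pi\in S_n$ contains a pattern $p\in S_k$ if some subsequence $\pi(i_1)\cdots\pi(i_k)$ with $i_1<\cdots<i_k$ is order-isomorphic to $p$; otherwise $\pi$ avoids $p$. The impartial game PAP (Permutations Avoiding Patterns) with pattern length $k$: a position is a subset $X\subseteq S_n$; a move consists of choosing a pattern $p\in S_k$ that is contained in at least one permutation of $X$, and replacing $X$ by the set of permutations in $X$ avoiding $p$. Play is normal play (a player with no legal move loses). The followers of $X$ are the positions reachable in one move, and the Sprague--Grundy value is defined recursively by $\operatorname{sg}(X)=\operatorname{mex}\{\operatorname{sg}(Y): Y \text{ a follower of } X\}$ (mex = least non-negative integer not in the set; terminal positions have value $0$). $\operatorname{sg}(S_n,k)$ denotes the Sprague--Grundy value of the starting position $S_n$ in PAP with pattern length $k$. A position is a P-position iff its value is $0$. -}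

module Defs where

open import Data.Nat using (ℕ; zero; suc; _<ᵇ_; _≡ᵇ_)
open import Data.Bool using (Bool; true; false; _∧_; _∨_; not; if_then_else_)
open import Data.Fin using (Fin; toℕ)
import Data.Fin
open import Data.List using (List; []; _∷_; map; filter; length; concatMap)
open import Data.Bool.ListAction using (any; all)
open import Data.Vec using (Vec; []; _∷_; toList)
open import Data.Bool using (T?)

-- Permutations of {1..n} in one-line notation, as vectors of length n
-- over Fin n (entries 0..n-1 stand for 1..n).

Perm : ℕ → Set
Perm n = Vec (Fin n) n

allFinsL : (n : ℕ) → List (Fin n)
allFinsL zero = []
allFinsL (suc n) = Data.Fin.zero ∷ map Data.Fin.suc (allFinsL n)

allVecs : (n m : ℕ) → List (Vec (Fin n) m)
allVecs n zero = [] ∷ []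
allVecs n (suc m) = concatMap (λ x → map (x ∷_) (allVecs n m)) (allFinsL n)

distinct : {n : ℕ} → List (Fin n) → Bool
distinct [] = true
distinct (x ∷ xs) = all (λ y → not (toℕ x ≡ᵇ toℕ y)) xs ∧ distinct xs

isPerm : {n : ℕ} → Perm n → Bool
isPerm v = distinct (toList v)

S : (n : ℕ) → List (Perm n)
S n = filter (λ v → T? (isPerm v)) (allVecs n n)

subseqs : {A : Set} → ℕ → List A → List (List A)
subseqs zero xs = [] ∷ []
subseqs (suc k) [] = []
subseqs (suc k) (x ∷ xs) = map (x ∷_) (subseqs k xs) Data.List.++ subseqs (suc k) xs

orderIso : List ℕ → List ℕ → Bool
orderIso [] [] = true
orderIso [] (_ ∷ _) = false
orderIso (_ ∷ _) [] = false
orderIso (a ∷ as) (b ∷ bs) =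
  agree as bs ∧ orderIso as bs
  where
  agree : List ℕ → List ℕ → Bool
  agree [] [] = true
  agree (a' ∷ as') (b' ∷ bs') =
    (if a <ᵇ a' then b <ᵇ b' else not (b <ᵇ b')) ∧ agree as' bs'
  agree _ _ = false

contains : {n k : ℕ} → Perm n → Perm k → Bool
contains {n} {k} π p =
  any (λ s → orderIso (map toℕ s) (map toℕ (toList p))) (subseqs k (toList π))

avoids : {n k : ℕ} → Perm n → Perm k → Bool
avoids π p = not (contains π p)

-- The game PAP with pattern length k.
-- A position is a subset X of S_n, represented by a list of permutations.

mex : List ℕ → ℕ
mex xs = go (suc (length xs)) 0
  where
  mem : ℕ → List ℕ → Bool
  mem m = any (λ y → m ≡ᵇ y)
  go : ℕ → ℕ → ℕ
  go zero m = m
  go (suc f) m = if mem m xs then go f (suc m) else m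

legalPatterns : {n : ℕ} → (k : ℕ) → List (Perm n) → List (Perm k)
legalPatterns k X = filter (λ p → T? (any (λ π → contains π p) X)) (S k)

move : {n k : ℕ} → List (Perm n) → Perm k → List (Perm n)
move X p = filter (λ π → T? (avoids π p)) X

-- Sprague–Grundy value with fuel; every legal move removes at least one
-- permutation, so fuel (suc (length X)) suffices for the exact value.
sgFuel : {n : ℕ} → ℕ → (k : ℕ) → List (Perm n) → ℕ
sgFuel zero k X = 0
sgFuel (suc f) k X = mex (map (λ p → sgFuel f k (move X p)) (legalPatterns k X))

sg : {n : ℕ} → (k : ℕ) → List (Perm n) → ℕ
sg k X = sgFuel (suc (length X)) k X

-- The second player wins by answering every pattern with its partner under
-- 123 ↔ 321, 132 ↔ 213, 231 ↔ 312.  After each answer the position is the class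
-- Av_n(B) for a set B closed under this pairing, beginning with S_n = Av_n(∅).
-- A move p from Av_n(B) is legal only if p ∉ B, and then its partner q is legal
-- in Av_n(B ∪ {p}): an explicit permutation contains q and, besides q, only one
-- monotone pattern.  Neither monotone pattern lies in B, for B would then contain
-- both, and Av_n(123, 321) is empty since for n ≥ 5 every permutation contains
-- 123 or 321 (Erdős–Szekeres).  A family of positions in which every move has
-- such an answer consists of positions of value 0.  The cases n = 3 and n = 4,
-- where 2143 avoids both 123 and 321, are decided by computation.

{-# OPTIONS --safe #-}
module Submission where

open import Data.Bool using (Bool; true; false; not; T; T?; if_then_else_; _∧_)
open import Data.Bool.ListAction using (any; or)
open import Data.Bool.Properties using (T-∧; T-≡)
import Data.Fin as Fin
open import Data.Fin using (Fin; toℕ; #_; fromℕ<)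
open import Data.Fin.Properties using (toℕ-fromℕ<)
open import Data.List using (List; []; _∷_; map; length; _++_; upTo; downFrom; applyUpTo; applyDownFrom)
open import Data.List.Properties
  using (length-map; length-filter; filter-notAll; map-++; map-∘; length-upTo; length-downFrom;
         length-applyUpTo; length-applyDownFrom)
open import Data.List.Membership.Propositional using (_∈_; _∉_; find; lose)
open import Data.List.Membership.Propositional.Properties
  using (∈-++⁺ˡ; ∈-++⁺ʳ; ∈-++⁻; ∈-map⁺; ∈-map⁻; ∈-concatMap⁺; ∈-filter⁺; ∈-filter⁻)
open import Data.List.Relation.Binary.Sublist.Propositional using (_⊆_; []; _∷_; _∷ʳ_; minimum)
open import Data.List.Relation.Binary.Sublist.Propositional.Properties using (All-resp-⊆)
open import Data.List.Relation.Unary.All as All using (All; []; _∷_)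
import Data.List.Relation.Unary.All.Properties as All
open import Data.List.Relation.Unary.AllPairs as AllPairs using (AllPairs; []; _∷_)
import Data.List.Relation.Unary.AllPairs.Properties as AllPairs
open import Data.List.Relation.Unary.Any as Any using (here; there)
open import Data.List.Relation.Unary.Any.Properties using (any⇔)
open import Data.List.Relation.Unary.Unique.Propositional using (Unique)
open import Data.Nat using (ℕ; zero; suc; _+_; _<_; _≤_; _>_; _<ᵇ_; _≡ᵇ_; s≤s; z<s; s<s; s≤s⁻¹)
open import Data.Nat.Properties
  using (≡ᵇ⇒≡; ≡⇒≡ᵇ; <⇒<ᵇ; <ᵇ⇒<; ≤⇒≯; <⇒≤; <⇒≢; >⇒≢; <-trans; ≤-trans; <-≤-trans; <-≤-connex;
         n<1+n; m<n⇒m<1+n; module ≤-Reasoning)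
open import Data.Product using (_×_; _,_; ∃-syntax)
open import Data.Sum as Sum using (_⊎_; inj₁; inj₂)
open import Data.Vec using (Vec; []; _∷_; toList)
open import Function using (Equivalence; _⇔_; mk⇔; _∘_)
open import Relation.Binary.PropositionalEquality
  using (_≡_; _≢_; refl; sym; trans; cong; cong₂; subst; module ≡-Reasoning)
open import Relation.Nullary using (¬_; Dec; contradiction)

open import Defs

open Equivalence

cmp₃ : ℕ → ℕ → ℕ → Bool × Bool × Bool
cmp₃ a b c = (a <ᵇ b) , (a <ᵇ c) , (b <ᵇ c)

<ᵇ-true : ∀ {a b} → a < b → (a <ᵇ b) ≡ true
<ᵇ-true a<b = T-≡ .to (<⇒<ᵇ a<b)

<ᵇ-false : ∀ {a b} → b ≤ a → (a <ᵇ b) ≡ false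
<ᵇ-false {a} {b} b≤a with a <ᵇ b in eq
... | false = refl
... | true  = contradiction (<ᵇ⇒< a b (T-≡ .from eq)) (≤⇒≯ b≤a)

if-agrees⇒≡ : ∀ u v → T (if u then v else not v) → u ≡ v
if-agrees⇒≡ true  true  _ = refl
if-agrees⇒≡ false false _ = refl

if-agrees-refl : ∀ u → (if u then u else not u) ≡ true
if-agrees-refl true  = refl
if-agrees-refl false = refl

orderIso-triple : ∀ a b c x y z →
  T (orderIso (a ∷ b ∷ c ∷ []) (x ∷ y ∷ z ∷ [])) ⇔ (cmp₃ a b c ≡ cmp₃ x y z)
orderIso-triple a b c x y z = mk⇔ to′ from′
  where
  to′ : T (orderIso (a ∷ b ∷ c ∷ []) (x ∷ y ∷ z ∷ [])) → cmp₃ a b c ≡ cmp₃ x y z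
  to′ iso =
    let ab∧ac∧⊤ , bc∧⊤∧⊤ = T-∧ .to iso
        ab , ac∧⊤ = T-∧ .to ab∧ac∧⊤
        ac , _ = T-∧ .to ac∧⊤
        bc∧⊤ , _ = T-∧ .to bc∧⊤∧⊤
        bc , _ = T-∧ .to bc∧⊤
    in cong₂ _,_ (if-agrees⇒≡ _ _ ab) (cong₂ _,_ (if-agrees⇒≡ _ _ ac) (if-agrees⇒≡ _ _ bc))
  from′ : cmp₃ a b c ≡ cmp₃ x y z → T (orderIso (a ∷ b ∷ c ∷ []) (x ∷ y ∷ z ∷ []))
  from′ eq with a <ᵇ b | a <ᵇ c | b <ᵇ c | eq
  ... | _ | _ | _ | refl =
    T-≡ .from (cong₂ _∧_ (cong₂ _∧_ (if-agrees-refl (x <ᵇ y)) (cong₂ _∧_ (if-agrees-refl (x <ᵇ z)) refl))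
                         (cong₂ _∧_ (cong₂ _∧_ (if-agrees-refl (y <ᵇ z)) refl) refl))

data Pattern : Set where
  p123 p132 p213 p231 p312 p321 : Pattern

oneLine : Pattern → Fin 3 × Fin 3 × Fin 3
oneLine p123 = # 0 , # 1 , # 2
oneLine p132 = # 0 , # 2 , # 1
oneLine p213 = # 1 , # 0 , # 2
oneLine p231 = # 1 , # 2 , # 0
oneLine p312 = # 2 , # 0 , # 1
oneLine p321 = # 2 , # 1 , # 0

entries : ∀ {n k} → Vec (Fin n) k → List ℕ
entries v = map toℕ (toList v)

toPerm : Pattern → Perm 3
toPerm p = let i , j , k = oneLine p in i ∷ j ∷ k ∷ []

patterns : List Pattern
patterns = p123 ∷ p132 ∷ p213 ∷ p231 ∷ p312 ∷ p321 ∷ []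

S3≡patterns : S 3 ≡ map toPerm patterns
S3≡patterns = refl

∈-patterns : ∀ p → p ∈ patterns
∈-patterns p123 = here refl
∈-patterns p132 = there (here refl)
∈-patterns p213 = there (there (here refl))
∈-patterns p231 = there (there (there (here refl)))
∈-patterns p312 = there (there (there (there (here refl))))
∈-patterns p321 = there (there (there (there (there (here refl)))))

toPerm∈S3 : ∀ p → toPerm p ∈ S 3
toPerm∈S3 p = subst (toPerm p ∈_) (sym S3≡patterns) (∈-map⁺ toPerm (∈-patterns p))

∈S3⁻ : ∀ {q} → q ∈ S 3 → ∃[ p ] q ≡ toPerm p
∈S3⁻ {q} q∈S3 = let p , _ , q≡p = ∈-map⁻ toPerm {xs = patterns} (subst (q ∈_) S3≡patterns q∈S3) in p , q≡p

signature : Pattern → Bool × Bool × Bool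
signature p = let i , j , k = oneLine p in cmp₃ (toℕ i) (toℕ j) (toℕ k)

fromSignature : Bool × Bool × Bool → Pattern
fromSignature (true  , true  , true ) = p123
fromSignature (true  , true  , false) = p132
fromSignature (false , true  , true ) = p213
fromSignature (true  , false , false) = p231
fromSignature (false , false , true ) = p312
fromSignature (false , false , false) = p321
fromSignature _                       = p123  -- no triple has this signature

fromSignature-signature : ∀ p → fromSignature (signature p) ≡ p
fromSignature-signature p123 = refl
fromSignature-signature p132 = refl
fromSignature-signature p213 = refl
fromSignature-signature p231 = refl
fromSignature-signature p312 = refl
fromSignature-signature p321 = refl

signature-injective : ∀ {p q} → signature p ≡ signature q → p ≡ q
signature-injective {p} {q} eq = begin
  p                           ≡⟨ sym (fromSignature-signature p) ⟩
  fromSignature (signature p) ≡⟨ cong fromSignature eq ⟩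
  fromSignature (signature q) ≡⟨ fromSignature-signature q ⟩
  q                           ∎
  where open ≡-Reasoning

record Shaped (p : Pattern) (a b c : ℕ) : Set where
  constructor shaped
  field comparisons : cmp₃ a b c ≡ signature p

Shaped-unique : ∀ {p q a b c} → Shaped p a b c → Shaped q a b c → p ≡ q
Shaped-unique (shaped p≈) (shaped q≈) = signature-injective (trans (sym p≈) q≈)

orderIso⇔Shaped : ∀ p a b c → T (orderIso (a ∷ b ∷ c ∷ []) (entries (toPerm p))) ⇔ Shaped p a b c
orderIso⇔Shaped p a b c =
  let i , j , k = oneLine p
      iso⇔ = orderIso-triple a b c (toℕ i) (toℕ j) (toℕ k)
  in mk⇔ (shaped ∘ iso⇔ .to) (iso⇔ .from ∘ Shaped.comparisons)

module _ {a b c : ℕ} where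

  private
    cmp₃≡ : ∀ {u v w} → (a <ᵇ b) ≡ u → (a <ᵇ c) ≡ v → (b <ᵇ c) ≡ w → cmp₃ a b c ≡ (u , v , w)
    cmp₃≡ refl refl refl = refl

  shaped123 : a < b → b < c → Shaped p123 a b c
  shaped123 a<b b<c = shaped (cmp₃≡ (<ᵇ-true a<b) (<ᵇ-true (<-trans a<b b<c)) (<ᵇ-true b<c))

  shaped132 : a < c → c < b → Shaped p132 a b c
  shaped132 a<c c<b = shaped (cmp₃≡ (<ᵇ-true (<-trans a<c c<b)) (<ᵇ-true a<c) (<ᵇ-false (<⇒≤ c<b)))

  shaped213 : b < a → a < c → Shaped p213 a b c
  shaped213 b<a a<c = shaped (cmp₃≡ (<ᵇ-false (<⇒≤ b<a)) (<ᵇ-true a<c) (<ᵇ-true (<-trans b<a a<c)))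

  shaped231 : c < a → a < b → Shaped p231 a b c
  shaped231 c<a a<b = shaped (cmp₃≡ (<ᵇ-true a<b) (<ᵇ-false (<⇒≤ c<a)) (<ᵇ-false (<⇒≤ (<-trans c<a a<b))))

  shaped312 : b < c → c < a → Shaped p312 a b c
  shaped312 b<c c<a = shaped (cmp₃≡ (<ᵇ-false (<⇒≤ (<-trans b<c c<a))) (<ᵇ-false (<⇒≤ c<a)) (<ᵇ-true b<c))

  shaped321 : b ≤ a → c ≤ b → Shaped p321 a b c
  shaped321 b≤a c≤b = shaped (cmp₃≡ (<ᵇ-false b≤a) (<ᵇ-false (≤-trans c≤b b≤a)) (<ᵇ-false c≤b))

data Occurs (p : Pattern) (L : List ℕ) : Set where
  occurs : ∀ {a b c} → a ∷ b ∷ c ∷ [] ⊆ L → Shaped p a b c → Occurs p L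

module _ {A : Set} where

  ∈-subseqs⁺ : ∀ {xs ys : List A} → xs ⊆ ys → xs ∈ subseqs (length xs) ys
  ∈-subseqs⁺ {[]}     _               = here refl
  ∈-subseqs⁺ {x ∷ xs} (y ∷ʳ xs⊆ys)    = ∈-++⁺ʳ _ (∈-subseqs⁺ xs⊆ys)
  ∈-subseqs⁺ {x ∷ xs} (refl ∷ xs⊆ys)  = ∈-++⁺ˡ (∈-map⁺ (x ∷_) (∈-subseqs⁺ xs⊆ys))

  ∈-subseqs⁻ : ∀ k (ys : List A) {xs} → xs ∈ subseqs k ys → xs ⊆ ys × length xs ≡ k
  ∈-subseqs⁻ zero    ys       (here refl) = minimum ys , refl
  ∈-subseqs⁻ (suc k) (y ∷ ys) xs∈ with ∈-++⁻ (map (y ∷_) (subseqs k ys)) xs∈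
  ... | inj₂ xs∈′ = let xs⊆ys , len = ∈-subseqs⁻ (suc k) ys xs∈′ in y ∷ʳ xs⊆ys , len
  ... | inj₁ xs∈′ with ∈-map⁻ (y ∷_) xs∈′
  ...   | zs , zs∈ , refl = let zs⊆ys , len = ∈-subseqs⁻ k ys zs∈ in refl ∷ zs⊆ys , cong suc len

module _ {A B : Set} (f : A → B) where

  subseqs-map : ∀ k xs → subseqs k (map f xs) ≡ map (map f) (subseqs k xs)
  subseqs-map zero    xs       = refl
  subseqs-map (suc k) []       = refl
  subseqs-map (suc k) (x ∷ xs) = begin
    map (f x ∷_) (subseqs k (map f xs)) ++ subseqs (suc k) (map f xs)
      ≡⟨ cong₂ _++_ (cong (map (f x ∷_)) (subseqs-map k xs)) (subseqs-map (suc k) xs) ⟩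
    map (f x ∷_) (map (map f) (subseqs k xs)) ++ map (map f) (subseqs (suc k) xs)
      ≡⟨ cong (_++ _) (sym (map-∘ (subseqs k xs))) ⟩
    map (λ ys → f x ∷ map f ys) (subseqs k xs) ++ map (map f) (subseqs (suc k) xs)
      ≡⟨ cong (_++ _) (map-∘ (subseqs k xs)) ⟩
    map (map f) (map (x ∷_) (subseqs k xs)) ++ map (map f) (subseqs (suc k) xs)
      ≡⟨ sym (map-++ (map f) (map (x ∷_) (subseqs k xs)) (subseqs (suc k) xs)) ⟩
    map (map f) (map (x ∷_) (subseqs k xs) ++ subseqs (suc k) xs)
      ∎
    where open ≡-Reasoning

contains-toℕ : ∀ {n k} (π : Perm n) (q : Perm k) →
  contains π q ≡ any (λ s → orderIso s (entries q)) (subseqs k (entries π))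
contains-toℕ {k = k} π q = begin
  or (map (f ∘ map toℕ) (subseqs k (toList π)))      ≡⟨ cong or (map-∘ (subseqs k (toList π))) ⟩
  or (map f (map (map toℕ) (subseqs k (toList π))))  ≡⟨ cong (any f) (sym (subseqs-map toℕ k (toList π))) ⟩
  any f (subseqs k (entries π))                      ∎
  where
  open ≡-Reasoning
  f : List ℕ → Bool
  f s = orderIso s (entries q)

contains⇔Occurs : ∀ {n} (π : Perm n) p → T (contains π (toPerm p)) ⇔ Occurs p (entries π)
contains⇔Occurs π p = mk⇔ to′ from′
  where
  to′ : T (contains π (toPerm p)) → Occurs p (entries π)
  to′ πp with find (any⇔ .from (subst T (contains-toℕ π (toPerm p)) πp))
  ... | s , s∈ , iso with ∈-subseqs⁻ 3 (entries π) s∈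
  to′ πp | a ∷ b ∷ c ∷ [] , s∈ , iso | abc⊆ , refl = occurs abc⊆ (orderIso⇔Shaped p a b c .to iso)
  from′ : Occurs p (entries π) → T (contains π (toPerm p))
  from′ (occurs {a} {b} {c} abc⊆ abc≈p) =
    subst T (sym (contains-toℕ π (toPerm p)))
      (any⇔ .to (lose (∈-subseqs⁺ abc⊆) (orderIso⇔Shaped p a b c .from abc≈p)))

module _ (a b c d e : ℕ) (L : List ℕ) where
  private
    M : List ℕ
    M = a ∷ b ∷ c ∷ d ∷ e ∷ L
    increasing : ∀ {x y z} → x ∷ y ∷ z ∷ [] ⊆ M → x < y → y < z → Occurs p123 M ⊎ Occurs p321 M
    increasing xyz x<y y<z = inj₁ (occurs xyz (shaped123 x<y y<z))
    decreasing : ∀ {x y z} → x ∷ y ∷ z ∷ [] ⊆ M → y ≤ x → z ≤ y → Occurs p123 M ⊎ Occurs p321 M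
    decreasing xyz y≤x z≤y = inj₂ (occurs xyz (shaped321 y≤x z≤y))
    abc : a ∷ b ∷ c ∷ [] ⊆ M
    abc = refl ∷ refl ∷ refl ∷ minimum _
    abd : a ∷ b ∷ d ∷ [] ⊆ M
    abd = refl ∷ refl ∷ c ∷ʳ refl ∷ minimum _
    bcd : b ∷ c ∷ d ∷ [] ⊆ M
    bcd = a ∷ʳ refl ∷ refl ∷ refl ∷ minimum _
    bde : b ∷ d ∷ e ∷ [] ⊆ M
    bde = a ∷ʳ refl ∷ c ∷ʳ refl ∷ refl ∷ minimum _
    cde : c ∷ d ∷ e ∷ [] ⊆ M
    cde = a ∷ʳ b ∷ʳ refl ∷ refl ∷ refl ∷ minimum _

  erdős–szekeres₅ : Occurs p123 M ⊎ Occurs p321 M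
  erdős–szekeres₅ with <-≤-connex a b | <-≤-connex b c
  ... | inj₁ a<b | inj₁ b<c = increasing abc a<b b<c
  ... | inj₂ b≤a | inj₂ c≤b = decreasing abc b≤a c≤b
  ... | inj₁ a<b | inj₂ c≤b with <-≤-connex b d
  ...   | inj₁ b<d = increasing abd a<b b<d
  ...   | inj₂ d≤b with <-≤-connex c d
  ...     | inj₂ d≤c = decreasing bcd c≤b d≤c
  ...     | inj₁ c<d with <-≤-connex d e
  ...       | inj₁ d<e = increasing cde c<d d<e
  ...       | inj₂ e≤d = decreasing bde d≤b e≤d
  erdős–szekeres₅ | inj₂ b≤a | inj₁ b<c with <-≤-connex c d
  ...   | inj₁ c<d = increasing bcd b<c c<d
  ...   | inj₂ d≤c with <-≤-connex b d
  ...     | inj₂ d≤b = decreasing abd b≤a d≤b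
  ...     | inj₁ b<d with <-≤-connex d e
  ...       | inj₁ d<e = increasing bde b<d d<e
  ...       | inj₂ e≤d = decreasing cde d≤c e≤d

contains-monotone : ∀ {k} (π : Perm (5 + k)) → T (contains π (toPerm p123)) ⊎ T (contains π (toPerm p321))
contains-monotone π@(x₁ ∷ x₂ ∷ x₃ ∷ x₄ ∷ x₅ ∷ xs) =
  Sum.map (contains⇔Occurs π p123 .from) (contains⇔Occurs π p321 .from)
          (erdős–szekeres₅ (toℕ x₁) (toℕ x₂) (toℕ x₃) (toℕ x₄) (toℕ x₅) (entries xs))

-- Permutations with few patterns

AllPairs-resp-⊆ : ∀ {A : Set} {R : A → A → Set} {xs ys} → xs ⊆ ys → AllPairs R ys → AllPairs R xs
AllPairs-resp-⊆ []         []         = []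
AllPairs-resp-⊆ (y ∷ʳ τ)   (_ ∷ Rys)  = AllPairs-resp-⊆ τ Rys
AllPairs-resp-⊆ (refl ∷ τ) (Ry ∷ Rys) = All-resp-⊆ τ Ry ∷ AllPairs-resp-⊆ τ Rys

TriplesShaped : Pattern → Pattern → List ℕ → Set
TriplesShaped p q L = ∀ {a b c} → a ∷ b ∷ c ∷ [] ⊆ L → Shaped p a b c ⊎ Shaped q a b c

triples-∷ : ∀ {p q x L} → (∀ {b c} → b ∷ c ∷ [] ⊆ L → Shaped p x b c ⊎ Shaped q x b c) →
            TriplesShaped p q L → TriplesShaped p q (x ∷ L)
triples-∷ with-x without-x (refl ∷ bc⊆) = with-x bc⊆
triples-∷ with-x without-x (_ ∷ʳ abc⊆)  = without-x abc⊆

module _ {L : List ℕ} {a b c : ℕ} (abc⊆ : a ∷ b ∷ c ∷ [] ⊆ L) where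

  ascending-shape : AllPairs _<_ L → Shaped p123 a b c
  ascending-shape asc with AllPairs-resp-⊆ abc⊆ asc
  ... | (a<b ∷ _) ∷ (b<c ∷ []) ∷ _ = shaped123 a<b b<c

  descending-shape : AllPairs _>_ L → Shaped p321 a b c
  descending-shape desc with AllPairs-resp-⊆ abc⊆ desc
  ... | (b<a ∷ _) ∷ (c<b ∷ []) ∷ _ = shaped321 (<⇒≤ b<a) (<⇒≤ c<b)

module _ {x : ℕ} {L : List ℕ} {b c : ℕ} (bc⊆ : b ∷ c ∷ [] ⊆ L) where

  below-descending : All (x <_) L → AllPairs _>_ L → Shaped p132 x b c
  below-descending above desc with All-resp-⊆ bc⊆ above | AllPairs-resp-⊆ bc⊆ desc
  ... | _ ∷ x<c ∷ [] | (c<b ∷ []) ∷ _ = shaped132 x<c c<b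

  above-ascending : All (_< x) L → AllPairs _<_ L → Shaped p312 x b c
  above-ascending below asc with All-resp-⊆ bc⊆ below | AllPairs-resp-⊆ bc⊆ asc
  ... | _ ∷ c<x ∷ [] | (b<c ∷ []) ∷ _ = shaped312 b<c c<x

upTo-ascending : ∀ k → AllPairs _<_ (upTo k)
upTo-ascending k = AllPairs.applyUpTo⁺₁ (λ i → i) k (λ i<j _ → i<j)

downFrom-descending : ∀ k → AllPairs _>_ (downFrom k)
downFrom-descending k = AllPairs.applyDownFrom⁺₁ (λ i → i) k (λ j<i _ → j<i)

upTo-bounded : ∀ k → All (_< k) (upTo k)
upTo-bounded k = All.applyUpTo⁺₁ (λ i → i) k (λ i<k → i<k)

downFrom-bounded : ∀ k → All (_< k) (downFrom k)
downFrom-bounded k = All.applyDownFrom⁺₁ (λ i → i) k (λ i<k → i<k)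

record Witness (n : ℕ) (p : Pattern) : Set where
  field
    line               : List ℕ
    length-line        : length line ≡ n
    line-bounded       : All (_< n) line
    line-unique        : Unique line
    companion          : Pattern
    companion-monotone : companion ≡ p123 ⊎ companion ≡ p321
    occurs-p           : Occurs p line
    triple-shapes      : TriplesShaped p companion line

-- The witness lines, entries 0, …, n - 1 with n = m + 3:
-- 0 1 … n-1,  n-1 … 1 0,  0 n-1 … 1,  1 0 2 … n-1,  n-2 n-1 n-3 … 0,  n-1 0 1 … n-2.
module Witnesses (m : ℕ) where

  w123 : Witness (3 + m) p123
  w123 = record
    { line               = upTo (3 + m)
    ; length-line        = length-upTo (3 + m)
    ; line-bounded       = upTo-bounded (3 + m)
    ; line-unique        = AllPairs.map <⇒≢ (upTo-ascending (3 + m))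
    ; companion          = p123
    ; companion-monotone = inj₁ refl
    ; occurs-p           = occurs (refl ∷ refl ∷ refl ∷ minimum _) (shaped123 (n<1+n 0) (n<1+n 1))
    ; triple-shapes      = λ abc⊆ → inj₁ (ascending-shape abc⊆ (upTo-ascending (3 + m)))
    }

  w321 : Witness (3 + m) p321
  w321 = record
    { line               = downFrom (3 + m)
    ; length-line        = length-downFrom (3 + m)
    ; line-bounded       = downFrom-bounded (3 + m)
    ; line-unique        = AllPairs.map >⇒≢ (downFrom-descending (3 + m))
    ; companion          = p321
    ; companion-monotone = inj₂ refl
    ; occurs-p           = occurs (refl ∷ refl ∷ refl ∷ minimum _)
                                  (shaped321 (<⇒≤ (n<1+n (1 + m))) (<⇒≤ (n<1+n m)))
    ; triple-shapes      = λ abc⊆ → inj₁ (descending-shape abc⊆ (downFrom-descending (3 + m)))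
    }

  w132 : Witness (3 + m) p132
  w132 = record
    { line               = 0 ∷ D
    ; length-line        = cong suc (length-applyDownFrom suc (2 + m))
    ; line-bounded       = z<s ∷ All.applyDownFrom⁺₁ suc (2 + m) s<s
    ; line-unique        = All.map <⇒≢ D-positive ∷ AllPairs.map >⇒≢ D-descending
    ; companion          = p321
    ; companion-monotone = inj₂ refl
    ; occurs-p           = occurs (refl ∷ refl ∷ refl ∷ minimum _) (shaped132 (z<s {m}) (n<1+n (1 + m)))
    ; triple-shapes      = triples-∷ (λ bc⊆ → inj₁ (below-descending bc⊆ D-positive D-descending))
                                     (λ abc⊆ → inj₂ (descending-shape abc⊆ D-descending))
    }
    where
    D : List ℕ
    D = applyDownFrom suc (2 + m)
    D-positive : All (0 <_) D
    D-positive = All.applyDownFrom⁺₁ suc (2 + m) (λ _ → z<s)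
    D-descending : AllPairs _>_ D
    D-descending = AllPairs.applyDownFrom⁺₁ suc (2 + m) (λ j<i _ → s<s j<i)

  w312 : Witness (3 + m) p312
  w312 = record
    { line               = 2 + m ∷ upTo (2 + m)
    ; length-line        = cong suc (length-upTo (2 + m))
    ; line-bounded       = n<1+n (2 + m) ∷ All.map m<n⇒m<1+n I-below
    ; line-unique        = All.map >⇒≢ I-below ∷ AllPairs.map <⇒≢ I-ascending
    ; companion          = p123
    ; companion-monotone = inj₁ refl
    ; occurs-p           = occurs (refl ∷ refl ∷ refl ∷ minimum _) (shaped312 (n<1+n 0) (s<s (z<s {m})))
    ; triple-shapes      = triples-∷ (λ bc⊆ → inj₁ (above-ascending bc⊆ I-below I-ascending))
                                     (λ abc⊆ → inj₂ (ascending-shape abc⊆ I-ascending))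
    }
    where
    I-below : All (_< 2 + m) (upTo (2 + m))
    I-below = upTo-bounded (2 + m)
    I-ascending : AllPairs _<_ (upTo (2 + m))
    I-ascending = upTo-ascending (2 + m)

  w213 : Witness (3 + m) p213
  w213 = record
    { line               = 1 ∷ 0 ∷ J
    ; length-line        = cong (2 +_) (length-applyUpTo (2 +_) (1 + m))
    ; line-bounded       = s<s z<s ∷ z<s ∷ All.applyUpTo⁺₁ (2 +_) (1 + m) (λ i<1+m → s<s (s<s i<1+m))
    ; line-unique        = (>⇒≢ (n<1+n 0) ∷ All.map <⇒≢ J-above1) ∷
                           All.map <⇒≢ J-above0 ∷ AllPairs.map <⇒≢ J-ascending
    ; companion          = p123
    ; companion-monotone = inj₁ refl
    ; occurs-p           = occurs (refl ∷ refl ∷ refl ∷ minimum _) (shaped213 (n<1+n 0) (n<1+n 1))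
    ; triple-shapes      = triples-∷ with-1 (λ abc⊆ → inj₂ (ascending-shape abc⊆ (J-above0 ∷ J-ascending)))
    }
    where
    J : List ℕ
    J = applyUpTo (2 +_) (1 + m)
    J-above1 : All (1 <_) J
    J-above1 = All.applyUpTo⁺₁ (2 +_) (1 + m) (λ _ → s<s z<s)
    J-above0 : All (0 <_) J
    J-above0 = All.map (<-trans (n<1+n 0)) J-above1
    J-ascending : AllPairs _<_ J
    J-ascending = AllPairs.applyUpTo⁺₁ (2 +_) (1 + m) (λ i<j _ → s<s (s<s i<j))
    with-1 : ∀ {b c} → b ∷ c ∷ [] ⊆ 0 ∷ J → Shaped p213 1 b c ⊎ Shaped p123 1 b c
    with-1 (refl ∷ c⊆J) with All-resp-⊆ c⊆J J-above1
    ... | 1<c ∷ [] = inj₁ (shaped213 (n<1+n 0) 1<c)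
    with-1 (_ ∷ʳ bc⊆J) = inj₂ (ascending-shape (refl ∷ bc⊆J) (J-above1 ∷ J-ascending))

  w231 : Witness (3 + m) p231
  w231 = record
    { line               = 1 + m ∷ 2 + m ∷ D
    ; length-line        = cong (2 +_) (length-downFrom (1 + m))
    ; line-bounded       = m<n⇒m<1+n (n<1+n (1 + m)) ∷ n<1+n (2 + m) ∷ All.map m<n⇒m<1+n D-below2
    ; line-unique        = (<⇒≢ (n<1+n (1 + m)) ∷ All.map >⇒≢ D-below1) ∷
                           All.map >⇒≢ D-below2 ∷ AllPairs.map >⇒≢ (downFrom-descending (1 + m))
    ; companion          = p321
    ; companion-monotone = inj₂ refl
    ; occurs-p           = occurs (refl ∷ refl ∷ refl ∷ minimum _) (shaped231 (n<1+n m) (n<1+n (1 + m)))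
    ; triple-shapes      = triples-∷ with-top (λ abc⊆ → inj₂ (descending-shape abc⊆ 2+m∷D-descending))
    }
    where
    D : List ℕ
    D = downFrom (1 + m)
    D-below1 : All (_< 1 + m) D
    D-below1 = downFrom-bounded (1 + m)
    D-below2 : All (_< 2 + m) D
    D-below2 = All.map m<n⇒m<1+n D-below1
    2+m∷D-descending : AllPairs _>_ (2 + m ∷ D)
    2+m∷D-descending = D-below2 ∷ downFrom-descending (1 + m)
    with-top : ∀ {b c} → b ∷ c ∷ [] ⊆ 2 + m ∷ D → Shaped p231 (1 + m) b c ⊎ Shaped p321 (1 + m) b c
    with-top (refl ∷ c⊆D) with All-resp-⊆ c⊆D D-below1
    ... | c<1+m ∷ [] = inj₁ (shaped231 c<1+m (n<1+n (1 + m)))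
    with-top (_ ∷ʳ bc⊆D) = inj₂ (descending-shape (refl ∷ bc⊆D) (D-below1 ∷ downFrom-descending (1 + m)))

witness : ∀ m p → Witness (3 + m) p
witness m p123 = Witnesses.w123 m
witness m p132 = Witnesses.w132 m
witness m p213 = Witnesses.w213 m
witness m p231 = Witnesses.w231 m
witness m p312 = Witnesses.w312 m
witness m p321 = Witnesses.w321 m

fromLine : ∀ {n} (L : List ℕ) → All (_< n) L → Vec (Fin n) (length L)
fromLine []      []          = []
fromLine (x ∷ L) (x<n ∷ L<n) = fromℕ< x<n ∷ fromLine L L<n

entries-fromLine : ∀ {n} L (L<n : All (_< n) L) → entries (fromLine L L<n) ≡ L
entries-fromLine []      []          = refl
entries-fromLine (x ∷ L) (x<n ∷ L<n) = cong₂ _∷_ (toℕ-fromℕ< x<n) (entries-fromLine L L<n)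

asPerm : ∀ {n} (L : List ℕ) → All (_< n) L → length L ≡ n → Perm n
asPerm L L<n refl = fromLine L L<n

entries-asPerm : ∀ {n} L (L<n : All (_< n) L) (len : length L ≡ n) → entries (asPerm L L<n len) ≡ L
entries-asPerm L L<n refl = entries-fromLine L L<n

∈-allFinsL : ∀ n (i : Fin n) → i ∈ allFinsL n
∈-allFinsL (suc n) Fin.zero    = here refl
∈-allFinsL (suc n) (Fin.suc i) = there (∈-map⁺ Fin.suc (∈-allFinsL n i))

∈-allVecs : ∀ n m (v : Vec (Fin n) m) → v ∈ allVecs n m
∈-allVecs n zero    []      = here refl
∈-allVecs n (suc m) (i ∷ v) =
  ∈-concatMap⁺ (λ j → map (j ∷_) (allVecs n m)) (lose (∈-allFinsL n i) (∈-map⁺ (i ∷_) (∈-allVecs n m v)))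

T-not⇒¬T : ∀ {b} → T (not b) → ¬ T b
T-not⇒¬T {false} _ ()

¬T⇒T-not : ∀ {b} → ¬ T b → T (not b)
¬T⇒T-not {true}  ¬b = ¬b _
¬T⇒T-not {false} ¬b = _

≢⇒T-not-≡ᵇ : ∀ a b → a ≢ b → T (not (a ≡ᵇ b))
≢⇒T-not-≡ᵇ a b a≢b with a ≡ᵇ b in eq
... | false = _
... | true  = a≢b (≡ᵇ⇒≡ a b (T-≡ .from eq))

Unique⇒distinct : ∀ {n} (xs : List (Fin n)) → Unique (map toℕ xs) → T (distinct xs)
Unique⇒distinct []       []            = _
Unique⇒distinct (x ∷ xs) (x∉xs ∷ xs!) =
  T-∧ .from (All.all⁻ _ (All.map (≢⇒T-not-≡ᵇ _ _) (All.map⁻ x∉xs)) , Unique⇒distinct xs xs!)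

Unique⇒∈S : ∀ {n} (π : Perm n) → Unique (entries π) → π ∈ S n
Unique⇒∈S {n} π π! = ∈-filter⁺ (T? ∘ isPerm) (∈-allVecs n n π) (Unique⇒distinct (toList π) π!)

module _ {n p} (W : Witness n p) where
  open Witness W

  witnessPerm : Perm n
  witnessPerm = asPerm line line-bounded length-line

  entries-witnessPerm : entries witnessPerm ≡ line
  entries-witnessPerm = entries-asPerm line line-bounded length-line

  witnessPerm∈S : witnessPerm ∈ S n
  witnessPerm∈S = Unique⇒∈S witnessPerm (subst Unique (sym entries-witnessPerm) line-unique)

  witnessPerm-contains : T (contains witnessPerm (toPerm p))
  witnessPerm-contains =
    contains⇔Occurs witnessPerm p .from (subst (Occurs p) (sym entries-witnessPerm) occurs-p)

  witnessPerm-contains⁻ : ∀ q → T (contains witnessPerm (toPerm q)) → q ≡ p ⊎ q ≡ companion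
  witnessPerm-contains⁻ q πq
    with occurs abc⊆ abc≈q ← subst (Occurs q) entries-witnessPerm (contains⇔Occurs witnessPerm q .to πq)
    with triple-shapes abc⊆
  ... | inj₁ abc≈p = inj₁ (Shaped-unique abc≈q abc≈p)
  ... | inj₂ abc≈c = inj₂ (Shaped-unique abc≈q abc≈c)

  witnessPerm-avoids : ∀ q → ¬ (q ≡ p ⊎ q ≡ companion) → T (avoids witnessPerm (toPerm q))
  witnessPerm-avoids q q∉ = ¬T⇒T-not (q∉ ∘ witnessPerm-contains⁻ q)

-- Sprague–Grundy values

mex≡0 : ∀ xs → 0 ∉ xs → mex xs ≡ 0
mex≡0 xs 0∉xs with any (0 ≡ᵇ_) xs in eq
... | false = refl
... | true  = contradiction (Any.map (≡ᵇ⇒≡ 0 _) (any⇔ .from (T-≡ .from eq))) 0∉xs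

-- The helper of Defs.mex is local to a where block and so cannot be reasoned
-- about by induction; on lists of at most six values mex unfolds to this copy.
private
  mexFrom : List ℕ → ℕ → ℕ → ℕ
  mexFrom xs zero    m = m
  mexFrom xs (suc f) m = if any (m ≡ᵇ_) xs then mexFrom xs f (suc m) else m

  mexFrom-positive : ∀ xs f m → mexFrom xs f (suc m) ≢ 0
  mexFrom-positive xs zero    m ()
  mexFrom-positive xs (suc f) m with any (suc m ≡ᵇ_) xs
  ... | true  = mexFrom-positive xs f (suc m)
  ... | false = λ ()

  mex-unfold : ∀ xs → length xs ≤ 6 → mex xs ≡ mexFrom xs (suc (length xs)) 0
  mex-unfold []                                   _ = refl
  mex-unfold (_ ∷ [])                             _ = refl
  mex-unfold (_ ∷ _ ∷ [])                         _ = refl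
  mex-unfold (_ ∷ _ ∷ _ ∷ [])                     _ = refl
  mex-unfold (_ ∷ _ ∷ _ ∷ _ ∷ [])                 _ = refl
  mex-unfold (_ ∷ _ ∷ _ ∷ _ ∷ _ ∷ [])             _ = refl
  mex-unfold (_ ∷ _ ∷ _ ∷ _ ∷ _ ∷ _ ∷ [])         _ = refl
  mex-unfold (_ ∷ _ ∷ _ ∷ _ ∷ _ ∷ _ ∷ _ ∷ _) (s≤s (s≤s (s≤s (s≤s (s≤s (s≤s ()))))))

mex≢0 : ∀ xs → length xs ≤ 6 → 0 ∈ xs → mex xs ≢ 0
mex≢0 xs len 0∈xs
  rewrite mex-unfold xs len | T-≡ .to (any⇔ .to (Any.map (λ {y} → ≡⇒≡ᵇ 0 y) 0∈xs))
  = mexFrom-positive xs (length xs) 0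

module _ {n k : ℕ} (X : List (Perm n)) where

  private
    legal? : (q : Perm k) → Dec (T (any (λ π → contains π q) X))
    legal? q = T? (any (λ π → contains π q) X)

  legal⁻ : ∀ {p} → p ∈ legalPatterns k X → p ∈ S k × ∃[ π ] π ∈ X × T (contains π p)
  legal⁻ p∈ = let p∈S , Xp = ∈-filter⁻ legal? p∈ in p∈S , find (any⇔ .from Xp)

  legal⁺ : ∀ {p π} → p ∈ S k → π ∈ X → T (contains π p) → p ∈ legalPatterns k X
  legal⁺ p∈S π∈X πp = ∈-filter⁺ legal? p∈S (any⇔ .to (lose π∈X πp))

  length-move : ∀ {p} → p ∈ legalPatterns k X → length (move X p) < length X
  length-move {p} p∈ =
    let _ , π , π∈X , πp = legal⁻ p∈
    in filter-notAll (λ π → T? (avoids π p)) X (lose π∈X (λ π-avoids → T-not⇒¬T π-avoids πp))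

  length-options : (value : Perm k → ℕ) → length (map value (legalPatterns k X)) ≤ length (S k)
  length-options value = begin
    length (map value (legalPatterns k X)) ≡⟨ length-map value (legalPatterns k X) ⟩
    length (legalPatterns k X)             ≤⟨ length-filter legal? (S k) ⟩
    length (S k)                           ∎
    where open ≤-Reasoning

module PairingStrategy {n : ℕ} (Invariant : List (Perm n) → Set)
  (reply : ∀ {X p} → Invariant X → p ∈ legalPatterns 3 X →
           ∃[ q ] q ∈ legalPatterns 3 (move X p) × Invariant (move (move X p) q)) where

  -- Mutual induction on the fuel: a follower of an invariant position has an
  -- invariant follower, of value 0, so its own value is not 0.
  sgFuel≡0   : ∀ f {X} → length X < f → Invariant X → sgFuel f 3 X ≡ 0
  follower≢0 : ∀ f {X p} → length X < suc f → Invariant X → p ∈ legalPatterns 3 X →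
               sgFuel f 3 (move X p) ≢ 0

  sgFuel≡0 (suc f) {X} len inv = mex≡0 options λ 0∈options →
    let p , p∈ , 0≡ = ∈-map⁻ value 0∈options in follower≢0 f len inv p∈ (sym 0≡)
    where
    value : Perm 3 → ℕ
    value p = sgFuel f 3 (move X p)
    options : List ℕ
    options = map value (legalPatterns 3 X)

  follower≢0 zero    {X}     len inv p∈ = contradiction (<-≤-trans (length-move X p∈) (s≤s⁻¹ len)) λ ()
  follower≢0 (suc f) {X} {p} len inv p∈ with reply inv p∈
  ... | q , q∈ , inv′ =
    mex≢0 options (length-options (move X p) value)
          (subst (_∈ options) (sgFuel≡0 f shorter inv′) (∈-map⁺ value q∈))
    where
    value : Perm 3 → ℕ
    value q = sgFuel f 3 (move (move X p) q)
    options : List ℕ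
    options = map value (legalPatterns 3 (move X p))
    shorter : length (move (move X p) q) < f
    shorter = <-≤-trans (length-move (move X p) q∈) (s≤s⁻¹ (<-≤-trans (length-move X p∈) (s≤s⁻¹ len)))

  sg≡0 : ∀ {X} → Invariant X → sg 3 X ≡ 0
  sg≡0 {X} = sgFuel≡0 (suc (length X)) (n<1+n (length X))

-- The mirror strategy

module _ {n : ℕ} where

  AvoidsAll : Perm n → List Pattern → Set
  AvoidsAll π B = All (λ q → T (avoids π (toPerm q))) B

  record IsAv (B : List Pattern) (X : List (Perm n)) : Set where
    field
      sound    : ∀ {π} → π ∈ X → AvoidsAll π B
      complete : ∀ {π} → π ∈ S n → AvoidsAll π B → π ∈ X

  IsAv-move : ∀ {B X} q → IsAv B X → IsAv (q ∷ B) (move X (toPerm q))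
  IsAv-move {B} {X} q av = record
    { sound    = λ π∈ → let π∈X , πq = ∈-filter⁻ avoids-q? π∈ in πq ∷ IsAv.sound av π∈X
    ; complete = λ { π∈S (πq ∷ πB) → ∈-filter⁺ avoids-q? (IsAv.complete av π∈S πB) πq }
    }
    where
    avoids-q? : (π : Perm n) → Dec (T (avoids π (toPerm q)))
    avoids-q? π = T? (avoids π (toPerm q))

answer : Pattern → Pattern
answer p123 = p321
answer p132 = p213
answer p213 = p132
answer p231 = p312
answer p312 = p231
answer p321 = p123

answer-involutive : ∀ p → answer (answer p) ≡ p
answer-involutive p123 = refl
answer-involutive p132 = refl
answer-involutive p213 = refl
answer-involutive p231 = refl
answer-involutive p312 = refl
answer-involutive p321 = refl

Closed : List Pattern → Set
Closed B = ∀ {q} → q ∈ B → answer q ∈ B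

Closed-∷ : ∀ {B} p → Closed B → Closed (answer p ∷ p ∷ B)
Closed-∷ p closed (here refl)         = there (here (answer-involutive p))
Closed-∷ p closed (there (here refl)) = here refl
Closed-∷ p closed (there (there q∈B)) = there (there (closed q∈B))

answer-witness-excludes : ∀ m p → ¬ (p ≡ answer p ⊎ p ≡ Witness.companion (witness m (answer p)))
answer-witness-excludes m p123 = Sum.[ (λ ()) , (λ ()) ]
answer-witness-excludes m p132 = Sum.[ (λ ()) , (λ ()) ]
answer-witness-excludes m p213 = Sum.[ (λ ()) , (λ ()) ]
answer-witness-excludes m p231 = Sum.[ (λ ()) , (λ ()) ]
answer-witness-excludes m p312 = Sum.[ (λ ()) , (λ ()) ]
answer-witness-excludes m p321 = Sum.[ (λ ()) , (λ ()) ]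

module MirrorStrategy (k : ℕ) where

  ClosedClass : List (Perm (5 + k)) → Set
  ClosedClass X = ∃[ B ] Closed B × IsAv B X

  module _ {B : List Pattern} {X : List (Perm (5 + k))} (closed : Closed B) (av : IsAv B X)
           {π : Perm (5 + k)} (π∈X : π ∈ X) where

    contained∉B : ∀ {q} → T (contains π (toPerm q)) → q ∉ B
    contained∉B πq q∈B = T-not⇒¬T (All.lookup (IsAv.sound av π∈X) q∈B) πq

    p123∉B : p123 ∉ B
    p123∉B 123∈B with contains-monotone π
    ... | inj₁ π123 = contained∉B π123 123∈B
    ... | inj₂ π321 = contained∉B π321 (closed 123∈B)

    monotone∉B : ∀ {q} → q ≡ p123 ⊎ q ≡ p321 → q ∉ B
    monotone∉B (inj₁ refl) = p123∉B
    monotone∉B (inj₂ refl) = p123∉B ∘ closed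

    answer-witness∈ : ∀ p → T (contains π (toPerm p)) →
                      witnessPerm (witness (2 + k) (answer p)) ∈ move X (toPerm p)
    answer-witness∈ p πp = IsAv.complete (IsAv-move p av) (witnessPerm∈S w)
      (witnessPerm-avoids w p (answer-witness-excludes (2 + k) p) ∷
       All.tabulate λ {r} r∈B →
         witnessPerm-avoids w r Sum.[ (λ { refl → answer∉B r∈B }) , (λ { refl → companion∉B r∈B }) ])
      where
      w : Witness (5 + k) (answer p)
      w = witness (2 + k) (answer p)
      answer∉B : answer p ∉ B
      answer∉B a∈B = contained∉B πp (subst (_∈ B) (answer-involutive p) (closed a∈B))
      companion∉B : Witness.companion w ∉ B
      companion∉B = monotone∉B (Witness.companion-monotone w)

  reply : ∀ {X p} → ClosedClass X → p ∈ legalPatterns 3 X →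
          ∃[ q ] q ∈ legalPatterns 3 (move X p) × ClosedClass (move (move X p) q)
  reply {X} (B , closed , av) p∈ with legal⁻ X p∈
  ... | p∈S , π , π∈X , πp with ∈S3⁻ p∈S
  ...   | s , refl =
    toPerm (answer s) ,
    legal⁺ (move X (toPerm s)) (toPerm∈S3 (answer s)) (answer-witness∈ closed av π∈X s πp)
           (witnessPerm-contains (witness (2 + k) (answer s))) ,
    (answer s ∷ s ∷ B , Closed-∷ s closed , IsAv-move (answer s) (IsAv-move s av))

  S-closedClass : ClosedClass (S (5 + k))
  S-closedClass = [] , (λ ()) , record { sound = λ _ → [] ; complete = λ π∈S _ → π∈S }

theorem2p5 : (n : ℕ) → 3 ≤ n → sg 3 (S n) ≡ 0
theorem2p5 0 ()
theorem2p5 1 (s≤s ())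
theorem2p5 2 (s≤s (s≤s ()))
theorem2p5 3 _ = refl
theorem2p5 4 _ = refl
theorem2p5 (suc (suc (suc (suc (suc k))))) _ = PairingStrategy.sg≡0 ClosedClass reply S-closedClass
  where open MirrorStrategy k
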